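{- Let $n\ge 2$ and $w\in D_n$. For $1\le i\le n-1$, $s_i\star w=h_{i,[i+1]}(s_iw)$. Moreover, $s_n\star w=h_{n-1,[-n]}(s_nw)$.
   Context: Order $\pm[n]$ totally by $1<2<\dots<n<-n<\dots<-2<-1$. A signed permutation is a bijection $w$ of $\pm[n]$ with $w(-a)=-w(a)$; it is even if an even number of $w(1),\dots,w(n)$ are negative. $D_n$ is the group of even signed permutations under composition $(uv)(a)=u(v(a))$, with Coxeter generators $s_i$ ($1\le i\le n-1$) exchanging $i$ and $i+1$ and fixing the other elements of $[n]$, and $s_n$ with $s_n(n-1)=-n$, $s_n(n)=-(n-1)$, $s_n(a)=a$ for $a\le n-2$. With $\ell$ the Coxeter length, the Demazure product of a generator $s$ and $y\in D_n$ is $s\star y=sy$ if $\ell(sy)>\ell(y)$, and $s\star y=y$ otherwise. The unfolding of a signed permutation $u$ is the sequence $u(1),\dots,u(n),-u(n),\dots,-u(1)$. For $t\in\pm[n]$ and an ordered list $L$ of distinct elements of $\pm[n]$, $h_{t,L}(u)$ is computed by: among elements of $L$ greater than $t$ appearing to the right of the entry $t$ in the unfolding of $u$, take the one $q$ occurring latest in $L$; if none, stop; otherwise exchange the entries $t$ and $q$ and the entries $-t$ and $-q$ in the unfolding (if $q=-t$, just exchange $t$ and $-t$), and repeat. -}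

module Defs where

open import Data.Nat using (ℕ; zero; suc; _+_; _≤_; _<_)
open import Data.Nat.Divisibility using (_∣_)
import Data.Nat as ℕ
open import Data.Fin using (Fin; toℕ; fromℕ; inject₁; opposite; _↑ˡ_; splitAt)
import Data.Fin as F
import Data.Fin.Properties as FP
open import Data.List using (List; []; _∷_; length; filter; last; allFin)
open import Data.Maybe using (Maybe; just; nothing)
open import Data.Sum using (_⊎_; inj₁; inj₂)
open import Data.Product using (Σ; _×_; _,_)
open import Data.Bool using (if_then_else_; _∧_)
open import Relation.Nullary using (does; _×-dec_)
open import Relation.Binary.PropositionalEquality using (_≡_; _≗_)
open import Function using (_∘_; id)
open import Function.Definitions using (Bijective)

-- The set ±[n], totally ordered by 1 < 2 < … < n < -n < … < -2 < -1,
-- is encoded as Fin (n + n) via its rank in this order: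
--   index p < n   encodes  p + 1,
--   index p ≥ n   encodes  -(2n - p).
-- So the order on ±[n] is the usual order on Fin, and a ↦ -a is
-- 'opposite'.

PM : ℕ → Set
PM n = Fin (n + n)

pos : ∀ {n} → Fin n → PM n
pos {n} j = j ↑ˡ n

neg : ∀ n → PM n → PM n
neg n = opposite

swap : ∀ n → PM n → PM n → PM n → PM n
swap n a b x = if does (x F.≟ a) then b else (if does (x F.≟ b) then a else x)

sswap : ∀ n → PM n → PM n → PM n → PM n
sswap n a b = if does (b F.≟ neg n a) then swap n a b
  else swap n a b ∘ swap n (neg n a) (neg n b)

-- Signed permutations, even signed permutations (elements of D_n).
-- Composition is function composition: (u v)(a) = u (v a).

IsSignedPerm : ∀ n → (PM n → PM n) → Set
IsSignedPerm n w = Bijective _≡_ _≡_ w × (∀ a → w (neg n a) ≡ neg n (w a))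

negCount : ∀ n → (PM n → PM n) → ℕ
negCount n w = length (filter (λ j → n ℕ.≤? toℕ (w (pos j))) (allFin n))

InD : ∀ n → (PM n → PM n) → Set
InD n w = IsSignedPerm n w × (2 ∣ negCount n w)

-- Coxeter generators of D_n, n = k + 2.
-- typeA j  (j : Fin (k+1))  is s_i with i = j + 1, 1 ≤ i ≤ n - 1;
-- spin                      is s_n.

data Gen (k : ℕ) : Set where
  typeA : Fin (suc k) → Gen k
  spin  : Gen k

sA : ∀ k → Fin (suc k) → PM (suc (suc k)) → PM (suc (suc k))
sA k j = sswap (suc (suc k)) (pos (inject₁ j)) (pos (F.suc j))

-- s_n : n-1 ↦ -n, n ↦ -(n-1)
sN : ∀ k → PM (suc (suc k)) → PM (suc (suc k))
sN k = sswap (suc (suc k)) (pos (inject₁ (fromℕ k))) (neg (suc (suc k)) (pos (fromℕ (suc k))))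

gen : ∀ k → Gen k → PM (suc (suc k)) → PM (suc (suc k))
gen k (typeA j) = sA k j
gen k spin      = sN k

prod : ∀ k → List (Gen k) → PM (suc (suc k)) → PM (suc (suc k))
prod k []       = id
prod k (g ∷ gs) = gen k g ∘ prod k gs

IsLength : ∀ k → (PM (suc (suc k)) → PM (suc (suc k))) → ℕ → Set
IsLength k w l =
  Σ (List (Gen k)) (λ ws → length ws ≡ l × prod k ws ≗ w)
  × (∀ ws → prod k ws ≗ w → l ≤ length ws)

-- Demazure product:  DemazureIs k s y z  means  s ⋆ y = z, i.e.
-- z = s y if ℓ(s y) > ℓ(y), and z = y otherwise.
DemazureIs : ∀ k → (PM (suc (suc k)) → PM (suc (suc k)))
           → (PM (suc (suc k)) → PM (suc (suc k)))
           → (PM (suc (suc k)) → PM (suc (suc k))) → Set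
DemazureIs k s y z =
  Σ ℕ λ a → Σ ℕ λ b → IsLength k y a × IsLength k (s ∘ y) b
    × ((a < b × z ≗ s ∘ y) ⊎ (b ≤ a × z ≗ y))

-- Unfolding u(1),…,u(n),-u(n),…,-u(1), as a function of the position
-- (positions 0,…,2n-1).
unfold : ∀ n → (PM n → PM n) → Fin (n + n) → PM n
unfold n u p with splitAt n p
... | inj₁ i = u (pos i)
... | inj₂ i = neg n (u (pos (opposite i)))

posIn : ∀ n → (PM n → PM n) → PM n → ℕ
posIn n u x = go (allFin (n + n))
  where
  go : List (Fin (n + n)) → ℕ
  go []       = n + n
  go (p ∷ ps) = if does (unfold n u p F.≟ x) then toℕ p else go ps

hChoice : ∀ n → PM n → List (PM n) → (PM n → PM n) → Maybe (PM n)
hChoice n t L u =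
  last (filter (λ q → (t FP.<? q) ×-dec (posIn n u t ℕ.<? posIn n u q)) L)

hIter : ∀ n → ℕ → PM n → List (PM n) → (PM n → PM n) → (PM n → PM n)
hIter n zero       t L u = u
hIter n (suc fuel) t L u with hChoice n t L u
... | nothing = u
... | just q  = hIter n fuel t L (sswap n t q ∘ u)

-- Each non-stopping step moves the entry t strictly to the
-- right in the unfolding (to the former position of q), so at most
-- 2n - 1 steps occur and fuel 2n suffices to reach the stop.
h : ∀ n → PM n → List (PM n) → (PM n → PM n) → (PM n → PM n)
h n = hIter n (n + n)

{-# OPTIONS --safe #-}
-- The inversion number inv w = #{(y , x) : y < x, y < -x, w x < w y} is the Coxeter length
-- on D_n.  A generator s with root (a , b) is a signed transposition that keeps the relative
-- order of every pair of entries except {a , b} and {-b , -a}, so inv (s w) = inv w ± 1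
-- according as w⁻¹ a < w⁻¹ b or not; and an even signed permutation without such descents
-- is the identity, so descents peel off a reduced word of length inv w.  In the unfolding
-- of s w the entries a and b stand at the positions w⁻¹ b and w⁻¹ a, so h stops at once
-- exactly when ℓ (s w) > ℓ w, and otherwise performs the single swap s, giving back w.
module Submission where

open import Defs
open import Data.Bool using (if_then_else_)
open import Data.Fin as F using (Fin; toℕ; opposite; inject₁; fromℕ; fromℕ<; _↑ʳ_; _<_)
import Data.Fin.Properties as Fₚ
open import Data.List using (List; []; _∷_; length; filter; tabulate; allFin; last)
open import Data.List.Properties using (filter-accept; filter-reject)
open import Data.Maybe using (just; nothing)
open import Data.Nat as ℕ using (ℕ; zero; suc; _+_; _*_; _∸_; s≤s)
open import Data.Nat.Divisibility using (_∣_; divides; ∣m+n∣m⇒∣n; ∣1⇒≡1)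
import Data.Nat.Properties as ℕₚ
open import Data.Nat.Tactic.RingSolver using (solve-∀)
open import Data.Product using (∃-syntax; _×_; _,_; proj₁; proj₂)
open import Data.Sum using (_⊎_; inj₁; inj₂)
open import Data.Vec.Functional using (removeAt)
open import Function using (_∘_; _∘′_; id)
open import Relation.Binary using (tri<; tri≈; tri>)
open import Relation.Binary.PropositionalEquality
open import Relation.Nullary using (Dec; yes; no; does; ¬_; contradiction; _×-dec_)
open import Algebra.Properties.CommutativeMonoid.Sum ℕₚ.+-0-commutativeMonoid
  using (sum; sum-remove; sum-cong-≗; sum-replicate-zero)

-- Finite sums and lists

indicator : ∀ {ℓ} {P : Set ℓ} → Dec P → ℕ
indicator (yes _) = 1
indicator (no _)  = 0

indicator-yes : ∀ {ℓ} {P : Set ℓ} → P → (P? : Dec P) → indicator P? ≡ 1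
indicator-yes p (yes _) = refl
indicator-yes p (no ¬p) = contradiction p ¬p

indicator-no : ∀ {ℓ} {P : Set ℓ} → ¬ P → (P? : Dec P) → indicator P? ≡ 0
indicator-no ¬p (yes p) = contradiction p ¬p
indicator-no ¬p (no _)  = refl

indicator-cong : ∀ {ℓ ℓ′} {P : Set ℓ} {Q : Set ℓ′} → (P → Q) → (Q → P) →
                 (P? : Dec P) (Q? : Dec Q) → indicator P? ≡ indicator Q?
indicator-cong P⇒Q Q⇒P (yes p) Q? = sym (indicator-yes (P⇒Q p) Q?)
indicator-cong P⇒Q Q⇒P (no ¬p) Q? = sym (indicator-no (¬p ∘ Q⇒P) Q?)

sum-zero : ∀ {m} {f : Fin m → ℕ} → (∀ i → f i ≡ 0) → sum f ≡ 0
sum-zero {m} f≡0 = trans (sum-cong-≗ f≡0) (sum-replicate-zero m)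

sum-agreeing-off : ∀ {m} {f g : Fin m → ℕ} (i : Fin m) → (∀ j → j ≢ i → f j ≡ g j) →
                   ∃[ r ] (sum f ≡ f i + r × sum g ≡ g i + r)
sum-agreeing-off {suc m} {f} {g} i f≡g =
  sum (removeAt f i) , sum-remove f ,
  trans (sum-remove g) (cong (g i +_) (sum-cong-≗ λ j → sym (f≡g (F.punchIn i j) (Fₚ.punchInᵢ≢i i j))))

sum-single : ∀ {m} {f : Fin m → ℕ} (i : Fin m) → f i ≡ 1 → (∀ j → j ≢ i → f j ≡ 0) → sum f ≡ 1
sum-single {m} {f} i fᵢ≡1 f≡0 with sum-agreeing-off {f = f} {g = λ _ → 0} i f≡0
... | r , f-split , 0-split = trans f-split (cong₂ _+_ fᵢ≡1 (trans (sym 0-split) (sum-replicate-zero m)))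

sum-agreeing-off₂ : ∀ {m} {f g : Fin m → ℕ} {i j : Fin m} → i ≢ j →
                    (∀ x → x ≢ i → x ≢ j → f x ≡ g x) →
                    ∃[ r ] (sum f ≡ f i + (f j + r) × sum g ≡ g i + (g j + r))
sum-agreeing-off₂ {suc m} {f} {g} {i} {j} i≢j f≡g = r , split f f-rest , split g g-rest
  where
  j′ = F.punchOut i≢j
  off-j′ : ∀ x → x ≢ j′ → removeAt f i x ≡ removeAt g i x
  off-j′ x x≢j′ = f≡g (F.punchIn i x) (Fₚ.punchInᵢ≢i i x) λ eq →
    x≢j′ (Fₚ.punchIn-injective i x j′ (trans eq (sym (Fₚ.punchIn-punchOut i≢j))))
  rest = sum-agreeing-off j′ off-j′
  r = proj₁ rest
  f-rest = proj₁ (proj₂ rest)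
  g-rest = proj₂ (proj₂ rest)
  split : (φ : Fin (suc m) → ℕ) → sum (removeAt φ i) ≡ φ (F.punchIn i j′) + r →
          sum φ ≡ φ i + (φ j + r)
  split φ φ-rest = trans (sum-remove φ)
    (cong (φ i +_) (trans φ-rest (cong (λ x → φ x + r) (Fₚ.punchIn-punchOut i≢j))))

sum²-agreeing-off : ∀ {m} {F G : Fin m → Fin m → ℕ} (p q : Fin m) →
                    (∀ y x → ¬ (y ≡ p × x ≡ q) → F y x ≡ G y x) →
                    ∃[ r ] (sum (sum ∘′ F) ≡ F p q + r × sum (sum ∘′ G) ≡ G p q + r)
sum²-agreeing-off {F = F} {G} p q F≡G
  with sum-agreeing-off {f = sum ∘′ F} {g = sum ∘′ G} p
         (λ y y≢p → sum-cong-≗ λ x → F≡G y x (y≢p ∘ proj₁))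
     | sum-agreeing-off {f = F p} {g = G p} q (λ x x≢q → F≡G p x (x≢q ∘ proj₂))
... | r , F-rows , G-rows | s , F-row , G-row =
  s + r ,
  trans F-rows (trans (cong (_+ r) F-row) (ℕₚ.+-assoc (F p q) s r)) ,
  trans G-rows (trans (cong (_+ r) G-row) (ℕₚ.+-assoc (G p q) s r))

length-filter-tabulate : ∀ {a p} {A : Set a} {P : A → Set p} (P? : ∀ x → Dec (P x)) {m} (f : Fin m → A) →
                         length (filter P? (tabulate f)) ≡ sum (λ i → indicator (P? (f i)))
length-filter-tabulate P? {zero}  f = refl
length-filter-tabulate P? {suc m} f with P? (f F.zero)
... | yes _ = cong suc (length-filter-tabulate P? (f ∘ F.suc))
... | no _  = length-filter-tabulate P? (f ∘ F.suc)

even-after-two-flips : ∀ {s s′ x x′ y y′ r} → s ≡ x + (y + r) → s′ ≡ x′ + (y′ + r) →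
                       x + x′ ≡ 1 → y + y′ ≡ 1 → 2 ∣ s → 2 ∣ s′
even-after-two-flips {s} {s′} {x} {x′} {y} {y′} {r} refl refl x+x′≡1 y+y′≡1 2∣s =
  ∣m+n∣m⇒∣n (divides (suc r) s+s′≡[1+r]*2) 2∣s
  where
  rearrange : ∀ x x′ y y′ r → x + (y + r) + (x′ + (y′ + r)) ≡ (x + x′) + (y + y′) + r * 2
  rearrange = solve-∀
  s+s′≡[1+r]*2 : s + s′ ≡ suc r * 2
  s+s′≡[1+r]*2 = trans (rearrange x x′ y y′ r) (cong₂ (λ p q → p + q + r * 2) x+x′≡1 y+y′≡1)

first-match : ∀ {a p} {A : Set a} {P : A → Set p} (P? : ∀ x → Dec (P x)) (key : A → ℕ) (go : List A → ℕ) →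
              (∀ x xs → go (x ∷ xs) ≡ (if does (P? x) then key x else go xs)) →
              ∀ {L} (f : Fin L → A) (i : Fin L) → P (f i) → (∀ j → P (f j) → j ≡ i) →
              ∀ {xs} → tabulate f ≡ xs → go xs ≡ key (f i)
first-match {P = P} P? key go go-∷ {suc L} f i P[fi] unique refl =
  trans (go-∷ (f F.zero) (tabulate (f ∘ F.suc))) (at-head-or-later i P[fi] unique (P? (f F.zero)))
  where
  at-head-or-later : ∀ i → P (f i) → (∀ j → P (f j) → j ≡ i) → (P[f0]? : Dec (P (f F.zero))) →
                     (if does P[f0]? then key (f F.zero) else go (tabulate (f ∘ F.suc))) ≡ key (f i)
  at-head-or-later i _ unique (yes P[f0]) = cong (key ∘ f) (unique F.zero P[f0])
  at-head-or-later F.zero P[f0] _ (no ¬P[f0]) = contradiction P[f0] ¬P[f0]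
  at-head-or-later (F.suc i) P[fi] unique (no _) =
    first-match P? key go go-∷ (f ∘ F.suc) i P[fi] (λ j P[fj] → Fₚ.suc-injective (unique (F.suc j) P[fj])) refl

-- Increasing sequences

Increasing : ∀ {m} → (Fin (suc m) → ℕ) → Set
Increasing {m} f = ∀ (j : Fin m) → f (inject₁ j) ℕ.< f (F.suc j)

increasing-≥ : ∀ {m} {f : Fin (suc m) → ℕ} → Increasing f → ∀ i → f F.zero + toℕ i ℕ.≤ f i
increasing-≥ {f = f} increasing F.zero = ℕₚ.≤-reflexive (ℕₚ.+-identityʳ (f F.zero))
increasing-≥ {suc m} {f} increasing (F.suc i) = begin
  f F.zero + suc (toℕ i)     ≡⟨ ℕₚ.+-suc (f F.zero) (toℕ i) ⟩
  suc (f F.zero) + toℕ i     ≤⟨ ℕₚ.+-monoˡ-≤ (toℕ i) (increasing F.zero) ⟩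
  f (F.suc F.zero) + toℕ i   ≤⟨ increasing-≥ {f = f ∘ F.suc} (increasing ∘ F.suc) i ⟩
  f (F.suc i)                ∎
  where open ℕₚ.≤-Reasoning

increasing-≤ : ∀ {m} {f : Fin (suc m) → ℕ} → Increasing f → ∀ i → f i + (m ∸ toℕ i) ℕ.≤ f (fromℕ m)
increasing-≤ {zero}  {f} increasing F.zero = ℕₚ.≤-reflexive (ℕₚ.+-identityʳ (f F.zero))
increasing-≤ {suc m} {f} increasing F.zero = begin
  f F.zero + suc m           ≡⟨ ℕₚ.+-suc (f F.zero) m ⟩
  suc (f F.zero) + m         ≤⟨ ℕₚ.+-monoˡ-≤ m (increasing F.zero) ⟩
  f (F.suc F.zero) + m       ≤⟨ increasing-≤ {f = f ∘ F.suc} (increasing ∘ F.suc) F.zero ⟩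
  f (fromℕ (suc m))          ∎
  where open ℕₚ.≤-Reasoning
increasing-≤ {suc m} {f} increasing (F.suc i) = increasing-≤ {f = f ∘ F.suc} (increasing ∘ F.suc) i

increasing-≡toℕ : ∀ {m} {f : Fin (suc m) → ℕ} → Increasing f → f (fromℕ m) ℕ.≤ m → ∀ i → f i ≡ toℕ i
increasing-≡toℕ {m} {f} increasing fₘ≤m i = ℕₚ.≤-antisym f≤i i≤f
  where
  i≤m : toℕ i ℕ.≤ m
  i≤m = ℕₚ.≤-pred (Fₚ.toℕ<n i)
  i≤f : toℕ i ℕ.≤ f i
  i≤f = ℕₚ.≤-trans (ℕₚ.m≤n+m (toℕ i) (f F.zero)) (increasing-≥ increasing i)
  f≤i : f i ℕ.≤ toℕ i
  f≤i = ℕₚ.+-cancelʳ-≤ (m ∸ toℕ i) (f i) (toℕ i)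
          (ℕₚ.≤-trans (increasing-≤ increasing i)
            (ℕₚ.≤-trans fₘ≤m (ℕₚ.≤-reflexive (sym (ℕₚ.m+[n∸m]≡n i≤m)))))

module _ {M : ℕ} where

  opposite-injective : {i j : Fin M} → opposite i ≡ opposite j → i ≡ j
  opposite-injective {i} {j} eq =
    trans (sym (Fₚ.opposite-involutive i)) (trans (cong opposite eq) (Fₚ.opposite-involutive j))

  opposite-reverses-< : {i j : Fin M} → i < j → opposite j < opposite i
  opposite-reverses-< {i} {j} i<j =
    subst₂ ℕ._<_ (sym (Fₚ.opposite-prop j)) (sym (Fₚ.opposite-prop i))
      (ℕₚ.∸-monoʳ-< (s≤s i<j) (Fₚ.toℕ<n j))

  ≢∧≯⇒< : {i j : Fin M} → i ≢ j → ¬ (j < i) → i < j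
  ≢∧≯⇒< {i} {j} i≢j j≮i with Fₚ.<-cmp i j
  ... | tri< i<j _ _ = i<j
  ... | tri≈ _ i≡j _ = contradiction i≡j i≢j
  ... | tri> _ _ j<i = contradiction j<i j≮i

  <-opposite : {i j : Fin M} → i < opposite j → j < opposite i
  <-opposite {i} {j} i<-j = subst (_< opposite i) (Fₚ.opposite-involutive j) (opposite-reverses-< i<-j)

  opposite-< : {i j : Fin M} → opposite i < j → opposite j < i
  opposite-< {i} {j} -i<j = subst (opposite j <_) (Fₚ.opposite-involutive i) (opposite-reverses-< -i<j)

-- Signed permutations of ±[n]

module Signed (n : ℕ) where

  Negative : PM n → Set
  Negative x = n ℕ.≤ toℕ x

  negative? : (x : PM n) → Dec (Negative x)
  negative? x = n ℕ.≤? toℕ x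

  opposite-positive : {x : PM n} → toℕ x ℕ.< n → Negative (opposite x)
  opposite-positive {x} x<n = subst (n ℕ.≤_) (sym (Fₚ.opposite-prop x))
    (subst (ℕ._≤ n + n ∸ suc (toℕ x)) (ℕₚ.m+n∸n≡m n n) (ℕₚ.∸-monoʳ-≤ (n + n) x<n))

  opposite-negative : {x : PM n} → Negative x → toℕ (opposite x) ℕ.< n
  opposite-negative {x} n≤x = subst₂ ℕ._<_ (sym (Fₚ.opposite-prop x)) (ℕₚ.m+n∸n≡m n n)
    (ℕₚ.∸-monoʳ-< (s≤s n≤x) (Fₚ.toℕ<n x))

  opposite-≢ : (x : PM n) → x ≢ opposite x
  opposite-≢ x x≡-x with toℕ x ℕ.<? n
  ... | yes x<n = ℕₚ.<⇒≱ x<n (subst Negative (sym x≡-x) (opposite-positive x<n))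
  ... | no  x≮n = ℕₚ.<⇒≱ (subst (λ y → toℕ y ℕ.< n) (sym x≡-x) (opposite-negative (ℕₚ.≮⇒≥ x≮n)))
                          (ℕₚ.≮⇒≥ x≮n)

  toℕ-pos : (j : Fin n) → toℕ (pos j) ≡ toℕ j
  toℕ-pos j = Fₚ.toℕ-↑ˡ j n

  pos-positive : (j : Fin n) → toℕ (pos j) ℕ.< n
  pos-positive j = subst (ℕ._< n) (sym (toℕ-pos j)) (Fₚ.toℕ<n j)

  pos-injective : {i j : Fin n} → pos i ≡ pos j → i ≡ j
  pos-injective = Fₚ.↑ˡ-injective n _ _

  pos-fromℕ< : {x : PM n} (x<n : toℕ x ℕ.< n) → pos (fromℕ< x<n) ≡ x
  pos-fromℕ< x<n = Fₚ.toℕ-injective (trans (toℕ-pos _) (Fₚ.toℕ-fromℕ< x<n))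

  _≈±_ : Fin n → PM n → Set
  j ≈± x = pos j ≡ x ⊎ pos j ≡ opposite x

  absolute : (x : PM n) → ∃[ j ] j ≈± x
  absolute x with toℕ x ℕ.<? n
  ... | yes x<n = fromℕ< x<n , inj₁ (pos-fromℕ< x<n)
  ... | no  x≮n = fromℕ< -x<n , inj₂ (pos-fromℕ< -x<n)
    where -x<n = opposite-negative (ℕₚ.≮⇒≥ x≮n)

  absolute-unique : {i j : Fin n} {x : PM n} → i ≈± x → j ≈± x → i ≡ j
  absolute-unique (inj₁ i≡x)  (inj₁ j≡x)  = pos-injective (trans i≡x (sym j≡x))
  absolute-unique (inj₂ i≡-x) (inj₂ j≡-x) = pos-injective (trans i≡-x (sym j≡-x))
  absolute-unique {i} {j} (inj₁ i≡x)  (inj₂ j≡-x) = contradiction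
    (subst Negative (sym j≡-x) (opposite-positive (subst (λ y → toℕ y ℕ.< n) i≡x (pos-positive i))))
    (ℕₚ.<⇒≱ (pos-positive j))
  absolute-unique {i} {j} (inj₂ i≡-x) (inj₁ j≡x)  = contradiction
    (subst Negative (sym i≡-x) (opposite-positive (subst (λ y → toℕ y ℕ.< n) j≡x (pos-positive j))))
    (ℕₚ.<⇒≱ (pos-positive i))

  record SignedPerm (w : PM n → PM n) : Set where
    field
      w⁻¹       : PM n → PM n
      inverseʳ  : ∀ x → w (w⁻¹ x) ≡ x
      injective : ∀ {x y} → w x ≡ w y → x ≡ y
      odd       : ∀ x → w (opposite x) ≡ opposite (w x)

    inverseˡ : ∀ x → w⁻¹ (w x) ≡ x
    inverseˡ x = injective (inverseʳ (w x))

    w⁻¹-odd : ∀ x → w⁻¹ (opposite x) ≡ opposite (w⁻¹ x)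
    w⁻¹-odd x = injective (trans (inverseʳ (opposite x))
                  (trans (cong opposite (sym (inverseʳ x))) (sym (odd (w⁻¹ x)))))

    w⁻¹-injective : ∀ {x y} → w⁻¹ x ≡ w⁻¹ y → x ≡ y
    w⁻¹-injective {x} {y} eq = trans (sym (inverseʳ x)) (trans (cong w eq) (inverseʳ y))

    w≡⇒≡w⁻¹ : ∀ {x a} → w x ≡ a → x ≡ w⁻¹ a
    w≡⇒≡w⁻¹ {x} refl = sym (inverseˡ x)

    ≈±-w⁻¹ : ∀ {j x} → w (pos j) ≡ x ⊎ w (pos j) ≡ opposite x → j ≈± w⁻¹ x
    ≈±-w⁻¹ (inj₁ wj≡x)  = inj₁ (w≡⇒≡w⁻¹ wj≡x)
    ≈±-w⁻¹ (inj₂ wj≡-x) = inj₂ (trans (w≡⇒≡w⁻¹ wj≡-x) (w⁻¹-odd _))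

    ≈±-w : ∀ {j x} → j ≈± w⁻¹ x → w (pos j) ≡ x ⊎ w (pos j) ≡ opposite x
    ≈±-w {j} {x} (inj₁ j≡w⁻¹x) = inj₁ (trans (cong w j≡w⁻¹x) (inverseʳ x))
    ≈±-w {j} {x} (inj₂ j≡-w⁻¹x) = inj₂ (trans (cong w j≡-w⁻¹x) (trans (odd _) (cong opposite (inverseʳ x))))


  isSignedPerm⇒SignedPerm : {w : PM n → PM n} → IsSignedPerm n w → SignedPerm w
  isSignedPerm⇒SignedPerm ((injective , surjective) , odd) = record
    { w⁻¹ = λ x → proj₁ (surjective x)
    ; inverseʳ = λ x → proj₂ (surjective x) refl
    ; injective = injective
    ; odd = odd
    }

  signedPerm⇒IsSignedPerm : {w : PM n → PM n} → SignedPerm w → IsSignedPerm n w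
  signedPerm⇒IsSignedPerm {w} σ =
    (injective , λ y → w⁻¹ y , λ {x} x≡w⁻¹y → trans (cong w x≡w⁻¹y) (inverseʳ y)) , odd
    where open SignedPerm σ

  Root : PM n → PM n → PM n → PM n → Set
  Root a b u v = (u ≡ a × v ≡ b) ⊎ (u ≡ opposite b × v ≡ opposite a)

  Root-< : {a b u v : PM n} → a < b → Root a b u v → u < v
  Root-< a<b (inj₁ (refl , refl)) = a<b
  Root-< a<b (inj₂ (refl , refl)) = opposite-reverses-< a<b

  record IsReflection (g : PM n → PM n) (a b : PM n) : Set where
    field
      involutive : ∀ x → g (g x) ≡ x
      odd        : ∀ x → g (opposite x) ≡ opposite (g x)
      a↦b        : g a ≡ b
      a<b        : a < b
      b≢-a       : b ≢ opposite a
      monotone   : ∀ {u v} → u < v → v ≢ opposite u → ¬ Root a b u v → g u < g v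

    b↦a : g b ≡ a
    b↦a = trans (cong g (sym a↦b)) (involutive a)

    g-< : g b < g a
    g-< = subst₂ _<_ (sym b↦a) (sym a↦b) a<b

    g--< : g (opposite a) < g (opposite b)
    g--< = subst₂ _<_ (sym (odd a)) (sym (odd b)) (opposite-reverses-< g-<)

    monotone-⇔ : ∀ {u v} → u ≢ v → v ≢ opposite u → ¬ Root a b u v → ¬ Root a b v u →
                 (u < v → g u < g v) × (g u < g v → u < v)
    monotone-⇔ {u} {v} u≢v v≢-u ¬uv ¬vu = monotone′ , reflect
      where
      monotone′ = λ u<v → monotone u<v v≢-u ¬uv
      u≢-v : u ≢ opposite v
      u≢-v u≡-v = v≢-u (trans (sym (Fₚ.opposite-involutive v)) (cong opposite (sym u≡-v)))
      reflect : g u < g v → u < v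
      reflect gu<gv with Fₚ.<-cmp u v
      ... | tri< u<v _ _ = u<v
      ... | tri≈ _ u≡v _ = contradiction u≡v u≢v
      ... | tri> _ _ v<u = contradiction gu<gv (Fₚ.<-asym (monotone v<u u≢-v ¬vu))

  reflection∘signedPerm : ∀ {g a b w} → IsReflection g a b → SignedPerm w → SignedPerm (g ∘ w)
  reflection∘signedPerm {g} {w = w} ρ σ = record
    { w⁻¹ = w⁻¹ ∘ g
    ; inverseʳ = λ x → trans (cong g (inverseʳ (g x))) (involutive x)
    ; injective = λ eq → injective (trans (sym (involutive _)) (trans (cong g eq) (involutive _)))
    ; odd = λ x → trans (cong g (SignedPerm.odd σ x)) (IsReflection.odd ρ (w x))
    }
    where
    open SignedPerm σ
    open IsReflection ρ using (involutive)

  -- Each pair {±y , ±x} with distinct absolute values has exactly one reduced representative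
  -- (y , x); these index the positive roots of D_n.
  Reduced : PM n → PM n → Set
  Reduced y x = y < x × y < opposite x

  reduced? : (y x : PM n) → Dec (Reduced y x)
  reduced? y x = (y Fₚ.<? x) ×-dec (y Fₚ.<? opposite x)

  inversion? : (w : PM n → PM n) (y x : PM n) → Dec (Reduced y x × w x < w y)
  inversion? w y x = reduced? y x ×-dec (w x Fₚ.<? w y)

  -- Opaque: for n = k + 2, Agda would otherwise unfold the double sum when comparing terms.
  opaque
    inversions : (PM n → PM n) → ℕ
    inversions w = sum λ y → sum λ x → indicator (inversion? w y x)

  non-reduced-no-inversion : ∀ u {y x} → ¬ Reduced y x → indicator (inversion? u y x) ≡ 0
  non-reduced-no-inversion u ¬reduced = indicator-no (¬reduced ∘ proj₁) (inversion? u _ _)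

  opaque
    unfolding inversions

    inversions-cong : ∀ {u w} → u ≗ w → inversions u ≡ inversions w
    inversions-cong {u} {w} u≗w = sum-cong-≗ λ y → sum-cong-≗ λ x →
      indicator-cong (λ (r , lt) → r , subst₂ _<_ (u≗w x) (u≗w y) lt)
                     (λ (r , lt) → r , subst₂ _<_ (sym (u≗w x)) (sym (u≗w y)) lt)
                     (inversion? u y x) (inversion? w y x)

    inversions-id : inversions id ≡ 0
    inversions-id = sum-zero λ y → sum-zero λ x →
      indicator-no (λ ((y<x , _) , x<y) → Fₚ.<-asym y<x x<y) (inversion? id y x)

  reduced-root-unique : ∀ {α β} → α < β → β ≢ opposite α →
    ∃[ p ] ∃[ q ] (Reduced p q × Root α β p q × (∀ {y x} → Reduced y x → Root α β y x → y ≡ p × x ≡ q))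
  reduced-root-unique {α} {β} α<β β≢-α with Fₚ.<-cmp α (opposite β)
  ... | tri< α<-β _ _ = α , β , (α<β , α<-β) , inj₁ (refl , refl) , unique
    where
    unique : ∀ {y x} → Reduced y x → Root α β y x → y ≡ α × x ≡ β
    unique _                (inj₁ yx≡αβ)         = yx≡αβ
    unique (_ , -β<--α) (inj₂ (refl , refl)) =
      contradiction (subst (opposite β <_) (Fₚ.opposite-involutive α) -β<--α) (Fₚ.<-asym α<-β)
  ... | tri≈ _ α≡-β _ = contradiction (trans (sym (Fₚ.opposite-involutive β)) (cong opposite (sym α≡-β))) β≢-α
  ... | tri> _ _ -β<α = opposite β , opposite α , reduced , inj₂ (refl , refl) , unique
    where
    reduced : Reduced (opposite β) (opposite α)
    reduced = opposite-reverses-< α<β , subst (opposite β <_) (sym (Fₚ.opposite-involutive α)) -β<α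
    unique : ∀ {y x} → Reduced y x → Root α β y x → y ≡ opposite β × x ≡ opposite α
    unique (_ , α<-β) (inj₁ (refl , refl)) = contradiction α<-β (Fₚ.<-asym -β<α)
    unique _          (inj₂ yx≡-β-α)       = yx≡-β-α

  module _ {g a b w} (ρ : IsReflection g a b) (σ : SignedPerm w) where
    open IsReflection ρ
    open SignedPerm σ renaming (odd to w-odd)

    Root-w : ∀ {y x} → Root (w⁻¹ a) (w⁻¹ b) y x → Root a b (w y) (w x)
    Root-w (inj₁ (refl , refl)) = inj₁ (inverseʳ a , inverseʳ b)
    Root-w (inj₂ (refl , refl)) =
      inj₂ (trans (w-odd (w⁻¹ b)) (cong opposite (inverseʳ b)) ,
            trans (w-odd (w⁻¹ a)) (cong opposite (inverseʳ a)))

    Root-w⁻¹ : ∀ {y x} → Root a b (w y) (w x) → Root (w⁻¹ a) (w⁻¹ b) y x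
    Root-w⁻¹ (inj₁ (wy≡a , wx≡b))   = inj₁ (w≡⇒≡w⁻¹ wy≡a , w≡⇒≡w⁻¹ wx≡b)
    Root-w⁻¹ (inj₂ (wy≡-b , wx≡-a)) =
      inj₂ (trans (w≡⇒≡w⁻¹ wy≡-b) (w⁻¹-odd b) , trans (w≡⇒≡w⁻¹ wx≡-a) (w⁻¹-odd a))

    w⁻¹b≢-w⁻¹a : w⁻¹ b ≢ opposite (w⁻¹ a)
    w⁻¹b≢-w⁻¹a eq = b≢-a (w⁻¹-injective (trans eq (sym (w⁻¹-odd a))))

    Root-inverted : ∀ {u v} → Root a b u v → g v < g u
    Root-inverted (inj₁ (refl , refl)) = g-<
    Root-inverted (inj₂ (refl , refl)) = g--<

    inversion-unchanged : w⁻¹ a < w⁻¹ b → ∀ {y x} → ¬ (Reduced y x × Root (w⁻¹ a) (w⁻¹ b) y x) →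
                          indicator (inversion? (g ∘ w) y x) ≡ indicator (inversion? w y x)
    inversion-unchanged α<β {y} {x} ¬root = by-reducedness (reduced? y x)
      where
      by-reducedness : Dec (Reduced y x) →
                       indicator (inversion? (g ∘ w) y x) ≡ indicator (inversion? w y x)
      by-reducedness (no ¬reduced) =
        trans (non-reduced-no-inversion (g ∘ w) ¬reduced) (sym (non-reduced-no-inversion w ¬reduced))
      by-reducedness (yes reduced@(y<x , y<-x)) =
        indicator-cong (λ (r , lt) → r , proj₂ ⇔ lt) (λ (r , lt) → r , proj₁ ⇔ lt)
                       (inversion? (g ∘ w) y x) (inversion? w y x)
        where
        ⇔ = monotone-⇔ (λ wx≡wy → Fₚ.<⇒≢ y<x (sym (injective wx≡wy)))
              (λ wy≡-wx → Fₚ.<⇒≢ y<-x (injective (trans wy≡-wx (sym (w-odd x)))))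
              (λ root → Fₚ.<-asym y<x (Root-< α<β (Root-w⁻¹ root)))
              (λ root → ¬root (reduced , Root-w⁻¹ root))

    opaque
      unfolding inversions

      inversions-ascent : w⁻¹ a < w⁻¹ b → inversions (g ∘ w) ≡ suc (inversions w)
      inversions-ascent α<β
        with reduced-root-unique α<β w⁻¹b≢-w⁻¹a
      ... | p , q , pq-reduced , pq-root , unique
        with sum²-agreeing-off {F = λ y x → indicator (inversion? (g ∘ w) y x)}
                               {G = λ y x → indicator (inversion? w y x)} p q
               (λ y x ¬pq → inversion-unchanged α<β λ (red , root) → ¬pq (unique red root))
      ... | r , gw-split , w-split = begin
        inversions (g ∘ w)                  ≡⟨ gw-split ⟩
        indicator (inversion? (g ∘ w) p q) + r  ≡⟨ cong (_+ r) pq-inverted ⟩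
        suc r                               ≡⟨ cong (λ i → suc (i + r)) pq-not-inverted ⟨
        suc (indicator (inversion? w p q) + r)  ≡⟨ cong suc w-split ⟨
        suc (inversions w)                  ∎
        where
        open ≡-Reasoning
        pq-inverted : indicator (inversion? (g ∘ w) p q) ≡ 1
        pq-inverted = indicator-yes (pq-reduced , Root-inverted (Root-w pq-root)) _
        pq-not-inverted : indicator (inversion? w p q) ≡ 0
        pq-not-inverted = indicator-no (λ (_ , wq<wp) → Fₚ.<-asym (Root-< a<b (Root-w pq-root)) wq<wp) _

  inversions-descent : ∀ {g a b w} (ρ : IsReflection g a b) (σ : SignedPerm w) →
                       SignedPerm.w⁻¹ σ b < SignedPerm.w⁻¹ σ a → inversions w ≡ suc (inversions (g ∘ w))
  inversions-descent {g} {w = w} ρ σ β<α = begin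
    inversions w            ≡⟨ inversions-cong (λ x → involutive (w x)) ⟨
    inversions (g ∘ g ∘ w)  ≡⟨ inversions-ascent ρ (reflection∘signedPerm ρ σ)
                                 (subst₂ (λ u v → w⁻¹ u < w⁻¹ v) (sym a↦b) (sym b↦a) β<α) ⟩
    suc (inversions (g ∘ w)) ∎
    where
    open ≡-Reasoning
    open IsReflection ρ
    open SignedPerm σ

  inversions-step-≤ : ∀ {g a b w} → IsReflection g a b → SignedPerm w →
                      inversions (g ∘ w) ℕ.≤ suc (inversions w)
  inversions-step-≤ {a = a} {b} ρ σ with Fₚ.<-cmp (SignedPerm.w⁻¹ σ a) (SignedPerm.w⁻¹ σ b)
  ... | tri< α<β _ _ = ℕₚ.≤-reflexive (inversions-ascent ρ σ α<β)
  ... | tri≈ _ α≡β _ = contradiction (SignedPerm.w⁻¹-injective σ α≡β) (Fₚ.<⇒≢ (IsReflection.a<b ρ))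
  ... | tri> _ _ β<α = ℕₚ.m≤n⇒m≤1+n (ℕₚ.≤-trans (ℕₚ.n≤1+n _) (ℕₚ.≤-reflexive (sym (inversions-descent ρ σ β<α))))

  data Moved (a b : PM n) : PM n → Set where
    at-a  : Moved a b a
    at-b  : Moved a b b
    at--a : Moved a b (opposite a)
    at--b : Moved a b (opposite b)

  data Orbit (a b x : PM n) : Set where
    moved : Moved a b x → Orbit a b x
    fixed : x ≢ a → x ≢ b → x ≢ opposite a → x ≢ opposite b → Orbit a b x

  ±-moved : ∀ {a b x y} → Moved a b y → Moved a b (opposite y) → x ≡ y ⊎ x ≡ opposite y → Moved a b x
  ±-moved moved-y _ (inj₁ refl) = moved-y
  ±-moved _ moved-−y (inj₂ refl) = moved-−y

  orbit : ∀ a b x → Orbit a b x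
  orbit a b x with x F.≟ a | x F.≟ b | x F.≟ opposite a | x F.≟ opposite b
  ... | yes refl | _        | _        | _        = moved at-a
  ... | no _     | yes refl | _        | _        = moved at-b
  ... | no _     | no _     | yes refl | _        = moved at--a
  ... | no _     | no _     | no _     | yes refl = moved at--b
  ... | no x≢a   | no x≢b   | no x≢-a  | no x≢-b  = fixed x≢a x≢b x≢-a x≢-b

  record IsSignedTransposition (g : PM n → PM n) (a b : PM n) : Set where
    field
      a↦b   : g a ≡ b
      b↦a   : g b ≡ a
      -a↦-b : g (opposite a) ≡ opposite b
      -b↦-a : g (opposite b) ≡ opposite a
      fixes : ∀ {x} → x ≢ a → x ≢ b → x ≢ opposite a → x ≢ opposite b → g x ≡ x

    involutive : ∀ x → g (g x) ≡ x
    involutive x with orbit a b x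
    ... | moved at-a  = trans (cong g a↦b) b↦a
    ... | moved at-b  = trans (cong g b↦a) a↦b
    ... | moved at--a = trans (cong g -a↦-b) -b↦-a
    ... | moved at--b = trans (cong g -b↦-a) -a↦-b
    ... | fixed x≢a x≢b x≢-a x≢-b = trans (cong g (fixes x≢a x≢b x≢-a x≢-b)) (fixes x≢a x≢b x≢-a x≢-b)

    odd : ∀ x → g (opposite x) ≡ opposite (g x)
    odd x with orbit a b x
    ... | moved at-a  = trans -a↦-b (cong opposite (sym a↦b))
    ... | moved at-b  = trans -b↦-a (cong opposite (sym b↦a))
    ... | moved at--a = trans (cong g (Fₚ.opposite-involutive a))
                          (trans a↦b (trans (sym (Fₚ.opposite-involutive b)) (cong opposite (sym -a↦-b))))
    ... | moved at--b = trans (cong g (Fₚ.opposite-involutive b))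
                          (trans b↦a (trans (sym (Fₚ.opposite-involutive a)) (cong opposite (sym -b↦-a))))
    ... | fixed x≢a x≢b x≢-a x≢-b =
      trans (fixes (x≢-a ∘ -x≡⇒x≡-) (x≢-b ∘ -x≡⇒x≡-) (x≢a ∘ opposite-injective) (x≢b ∘ opposite-injective))
            (cong opposite (sym (fixes x≢a x≢b x≢-a x≢-b)))
      where
      -x≡⇒x≡- : ∀ {y} → opposite x ≡ y → x ≡ opposite y
      -x≡⇒x≡- refl = sym (Fₚ.opposite-involutive x)

  swap-a : ∀ a b → swap n a b a ≡ b
  swap-a a b with a F.≟ a
  ... | yes _   = refl
  ... | no a≢a = contradiction refl a≢a

  swap-b : ∀ a b → swap n a b b ≡ a
  swap-b a b with b F.≟ a | b F.≟ b
  ... | yes b≡a | _       = b≡a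
  ... | no _    | yes _   = refl
  ... | no _    | no b≢b = contradiction refl b≢b

  swap-fixes : ∀ {a b x} → x ≢ a → x ≢ b → swap n a b x ≡ x
  swap-fixes {a} {b} {x} x≢a x≢b with x F.≟ a | x F.≟ b
  ... | yes x≡a | _       = contradiction x≡a x≢a
  ... | no _    | yes x≡b = contradiction x≡b x≢b
  ... | no _    | no _    = refl

  sswap-isSignedTransposition : ∀ {a b} → a < b → b < opposite a →
                                IsSignedTransposition (sswap n a b) a b
  sswap-isSignedTransposition {a} {b} a<b b<-a with b F.≟ opposite a
  ... | yes b≡-a = contradiction b≡-a (Fₚ.<⇒≢ b<-a)
  ... | no _ = record
    { a↦b   = trans (cong (swap n a b) (swap-fixes a≢-a a≢-b)) (swap-a a b)
    ; b↦a   = trans (cong (swap n a b) (swap-fixes b≢-a b≢-b)) (swap-b a b)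
    ; -a↦-b = trans (cong (swap n a b) (swap-a (opposite a) (opposite b))) (swap-fixes (a≢-b ∘ sym) (b≢-b ∘ sym))
    ; -b↦-a = trans (cong (swap n a b) (swap-b (opposite a) (opposite b))) (swap-fixes (a≢-a ∘ sym) (b≢-a ∘ sym))
    ; fixes = λ x≢a x≢b x≢-a x≢-b → trans (cong (swap n a b) (swap-fixes x≢-a x≢-b)) (swap-fixes x≢a x≢b)
    }
    where
    a≢-a = Fₚ.<⇒≢ (Fₚ.<-trans a<b b<-a)
    a≢-b = Fₚ.<⇒≢ (<-opposite b<-a)
    b≢-a = Fₚ.<⇒≢ b<-a
    b≢-b = opposite-≢ b

  -- Apart from -b, no entry lies strictly between a and b, so g moves no entry past a fixed one.
  module _ {g a b} (τ : IsSignedTransposition g a b) (a<b : a < b) (b<-a : b < opposite a)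
           (between : ∀ {z} → a < z → z < b → z ≡ opposite b) where
    open IsSignedTransposition τ

    private
      a<-b : a < opposite b
      a<-b = <-opposite b<-a

      -b<-a : opposite b < opposite a
      -b<-a = opposite-reverses-< a<b

      a<-a : a < opposite a
      a<-a = Fₚ.<-trans a<b b<-a

      between′ : ∀ {z} → opposite b < z → z < opposite a → z ≡ b
      between′ -b<z z<-a = opposite-injective (between (<-opposite z<-a) (opposite-< -b<z))

      moved-moved : ∀ {u v} → Moved a b u → Moved a b v → u < v → v ≢ opposite u → ¬ Root a b u v → g u < g v
      moved-moved at-a  at-a  u<v _ _    = contradiction u<v (ℕₚ.n≮n _)
      moved-moved at-a  at-b  _ _ ¬root  = contradiction (inj₁ (refl , refl)) ¬root
      moved-moved at-a  at--a _ v≢-u _   = contradiction refl v≢-u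
      moved-moved at-a  at--b _ _ _      = subst₂ _<_ (sym a↦b) (sym -b↦-a) b<-a
      moved-moved at-b  at-a  u<v _ _    = contradiction u<v (Fₚ.<-asym a<b)
      moved-moved at-b  at-b  u<v _ _    = contradiction u<v (ℕₚ.n≮n _)
      moved-moved at-b  at--a _ _ _      = subst₂ _<_ (sym b↦a) (sym -a↦-b) a<-b
      moved-moved at-b  at--b _ v≢-u _   = contradiction refl v≢-u
      moved-moved at--a at-a  u<v _ _    = contradiction u<v (Fₚ.<-asym a<-a)
      moved-moved at--a at-b  u<v _ _    = contradiction u<v (Fₚ.<-asym b<-a)
      moved-moved at--a at--a u<v _ _    = contradiction u<v (ℕₚ.n≮n _)
      moved-moved at--a at--b u<v _ _    = contradiction u<v (Fₚ.<-asym -b<-a)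
      moved-moved at--b at-a  u<v _ _    = contradiction u<v (Fₚ.<-asym a<-b)
      moved-moved at--b at-b  _ v≢-u _   = contradiction (sym (Fₚ.opposite-involutive b)) v≢-u
      moved-moved at--b at--a _ _ ¬root  = contradiction (inj₂ (refl , refl)) ¬root
      moved-moved at--b at--b u<v _ _    = contradiction u<v (ℕₚ.n≮n _)

      fixed-moved : ∀ {x v} → x ≢ a → x ≢ b → x ≢ opposite a → x ≢ opposite b → Moved a b v → x < v → x < g v
      fixed-moved _   _   _    _    at-a  x<a  = subst (_ <_) (sym a↦b) (Fₚ.<-trans x<a a<b)
      fixed-moved x≢a _   _    x≢-b at-b  x<b  =
        subst (_ <_) (sym b↦a) (≢∧≯⇒< x≢a λ a<x → x≢-b (between a<x x<b))
      fixed-moved _   x≢b _    x≢-b at--a x<-a =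
        subst (_ <_) (sym -a↦-b) (≢∧≯⇒< x≢-b λ -b<x → x≢b (between′ -b<x x<-a))
      fixed-moved _   _   _    _    at--b x<-b = subst (_ <_) (sym -b↦-a) (Fₚ.<-trans x<-b -b<-a)

      moved-fixed : ∀ {u x} → x ≢ a → x ≢ b → x ≢ opposite a → x ≢ opposite b → Moved a b u → u < x → g u < x
      moved-fixed _   x≢b _    x≢-b at-a  a<x  =
        subst (_< _) (sym a↦b) (≢∧≯⇒< (x≢b ∘ sym) λ x<b → x≢-b (between a<x x<b))
      moved-fixed _   _   _    _    at-b  b<x  = subst (_< _) (sym b↦a) (Fₚ.<-trans a<b b<x)
      moved-fixed _   _   _    _    at--a -a<x = subst (_< _) (sym -a↦-b) (Fₚ.<-trans -b<-a -a<x)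
      moved-fixed _   x≢b x≢-a _    at--b -b<x =
        subst (_< _) (sym -b↦-a) (≢∧≯⇒< (x≢-a ∘ sym) λ x<-a → x≢b (between′ -b<x x<-a))

      monotone : ∀ {u v} → Orbit a b u → Orbit a b v → u < v → v ≢ opposite u → ¬ Root a b u v → g u < g v
      monotone (moved mu) (moved mv) = moved-moved mu mv
      monotone (fixed u≢a u≢b u≢-a u≢-b) (moved mv) u<v _ _ =
        subst (_< _) (sym (fixes u≢a u≢b u≢-a u≢-b)) (fixed-moved u≢a u≢b u≢-a u≢-b mv u<v)
      monotone (moved mu) (fixed v≢a v≢b v≢-a v≢-b) u<v _ _ =
        subst (_ <_) (sym (fixes v≢a v≢b v≢-a v≢-b)) (moved-fixed v≢a v≢b v≢-a v≢-b mu u<v)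
      monotone (fixed u≢a u≢b u≢-a u≢-b) (fixed v≢a v≢b v≢-a v≢-b) u<v _ _ =
        subst₂ _<_ (sym (fixes u≢a u≢b u≢-a u≢-b)) (sym (fixes v≢a v≢b v≢-a v≢-b)) u<v

    signedTransposition⇒reflection : IsReflection g a b
    signedTransposition⇒reflection = record
      { involutive = involutive
      ; odd        = odd
      ; a↦b        = a↦b
      ; a<b        = a<b
      ; b≢-a       = Fₚ.<⇒≢ b<-a
      ; monotone   = λ {u} {v} → monotone (orbit a b u) (orbit a b v)
      }

  𝟙-negative : PM n → ℕ
  𝟙-negative x = indicator (negative? x)

  positive⇒𝟙≡0 : ∀ {x} → toℕ x ℕ.< n → 𝟙-negative x ≡ 0
  positive⇒𝟙≡0 x<n = indicator-no (ℕₚ.<⇒≱ x<n) _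

  negative⇒𝟙≡1 : ∀ {x} → Negative x → 𝟙-negative x ≡ 1
  negative⇒𝟙≡1 x-negative = indicator-yes x-negative _

  negCount-sum : ∀ w → negCount n w ≡ sum (λ (j : Fin n) → 𝟙-negative (w (pos j)))
  negCount-sum w = length-filter-tabulate (λ (j : Fin n) → negative? (w (pos j))) id

  module _ {g a b} (τ : IsSignedTransposition g a b) where
    open IsSignedTransposition τ

    sign-preserved : toℕ a ℕ.< n → toℕ b ℕ.< n → ∀ x → 𝟙-negative (g x) ≡ 𝟙-negative x
    sign-preserved a<n b<n x with orbit a b x
    ... | moved at-a  = trans (cong 𝟙-negative a↦b) (trans (positive⇒𝟙≡0 b<n) (sym (positive⇒𝟙≡0 a<n)))
    ... | moved at-b  = trans (cong 𝟙-negative b↦a) (trans (positive⇒𝟙≡0 a<n) (sym (positive⇒𝟙≡0 b<n)))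
    ... | moved at--a = trans (cong 𝟙-negative -a↦-b) (trans (negative⇒𝟙≡1 (opposite-positive b<n))
                                                           (sym (negative⇒𝟙≡1 (opposite-positive a<n))))
    ... | moved at--b = trans (cong 𝟙-negative -b↦-a) (trans (negative⇒𝟙≡1 (opposite-positive a<n))
                                                           (sym (negative⇒𝟙≡1 (opposite-positive b<n))))
    ... | fixed x≢a x≢b x≢-a x≢-b = cong 𝟙-negative (fixes x≢a x≢b x≢-a x≢-b)

    sign-flipped : toℕ a ℕ.< n → Negative b → ∀ {x} → Moved a b x → 𝟙-negative x + 𝟙-negative (g x) ≡ 1
    sign-flipped a<n b-negative at-a  =
      cong₂ _+_ (positive⇒𝟙≡0 a<n) (trans (cong 𝟙-negative a↦b) (negative⇒𝟙≡1 b-negative))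
    sign-flipped a<n b-negative at-b  =
      cong₂ _+_ (negative⇒𝟙≡1 b-negative) (trans (cong 𝟙-negative b↦a) (positive⇒𝟙≡0 a<n))
    sign-flipped a<n b-negative at--a =
      cong₂ _+_ (negative⇒𝟙≡1 (opposite-positive a<n))
                (trans (cong 𝟙-negative -a↦-b) (positive⇒𝟙≡0 (opposite-negative b-negative)))
    sign-flipped a<n b-negative at--b =
      cong₂ _+_ (positive⇒𝟙≡0 (opposite-negative b-negative))
                (trans (cong 𝟙-negative -b↦-a) (negative⇒𝟙≡1 (opposite-positive a<n)))

    negCount-preserved : toℕ a ℕ.< n → toℕ b ℕ.< n → ∀ w → negCount n (g ∘ w) ≡ negCount n w
    negCount-preserved a<n b<n w = begin
      negCount n (g ∘ w)                         ≡⟨ negCount-sum (g ∘ w) ⟩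
      sum (λ j → 𝟙-negative (g (w (pos {n} j)))) ≡⟨ sum-cong-≗ (sign-preserved a<n b<n ∘ w ∘ pos {n}) ⟩
      sum (λ j → 𝟙-negative (w (pos {n} j)))     ≡⟨ negCount-sum w ⟨
      negCount n w                               ∎
      where open ≡-Reasoning

    negCount-parity-preserved : toℕ a ℕ.< n → Negative b → a < b → b < opposite a →
                                ∀ {w} → SignedPerm w → 2 ∣ negCount n w → 2 ∣ negCount n (g ∘ w)
    negCount-parity-preserved a<n b-negative a<b b<-a {w} σ 2∣negCount =
      subst (2 ∣_) (sym (negCount-sum (g ∘ w)))
        (even-after-two-flips {x = f ja} {f′ ja} {f jb} {f′ jb} (proj₁ (proj₂ split)) (proj₂ (proj₂ split))
          (sign-flipped a<n b-negative (±-moved at-a at--a (≈±-w ja≈±)))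
          (sign-flipped a<n b-negative (±-moved at-b at--b (≈±-w jb≈±)))
          (subst (2 ∣_) (negCount-sum w) 2∣negCount))
      where
      open SignedPerm σ using (w⁻¹; ≈±-w; ≈±-w⁻¹)

      f f′ : Fin n → ℕ
      f  j = 𝟙-negative (w (pos j))
      f′ j = 𝟙-negative (g (w (pos j)))

      ja = proj₁ (absolute (w⁻¹ a))
      ja≈± = proj₂ (absolute (w⁻¹ a))
      jb = proj₁ (absolute (w⁻¹ b))
      jb≈± = proj₂ (absolute (w⁻¹ b))

      ja≢jb : ja ≢ jb
      ja≢jb ja≡jb with ≈±-w ja≈± | ≈±-w (subst (_≈± w⁻¹ b) (sym ja≡jb) jb≈±)
      ... | inj₁ ≡a  | inj₁ ≡b  = Fₚ.<⇒≢ a<b (trans (sym ≡a) ≡b)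
      ... | inj₁ ≡a  | inj₂ ≡-b = Fₚ.<⇒≢ (<-opposite b<-a) (trans (sym ≡a) ≡-b)
      ... | inj₂ ≡-a | inj₁ ≡b  = Fₚ.<⇒≢ b<-a (trans (sym ≡b) ≡-a)
      ... | inj₂ ≡-a | inj₂ ≡-b = Fₚ.<⇒≢ a<b (opposite-injective (trans (sym ≡-a) ≡-b))

      agree-off : ∀ j → j ≢ ja → j ≢ jb → f j ≡ f′ j
      agree-off j j≢ja j≢jb = cong 𝟙-negative (sym (fixes
        (j≢ja ∘ is-ja ∘ inj₁) (j≢jb ∘ is-jb ∘ inj₁) (j≢ja ∘ is-ja ∘ inj₂) (j≢jb ∘ is-jb ∘ inj₂)))
        where
        is-ja : w (pos j) ≡ a ⊎ w (pos j) ≡ opposite a → j ≡ ja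
        is-ja wj≈±a = absolute-unique (≈±-w⁻¹ wj≈±a) ja≈±
        is-jb : w (pos j) ≡ b ⊎ w (pos j) ≡ opposite b → j ≡ jb
        is-jb wj≈±b = absolute-unique (≈±-w⁻¹ wj≈±b) jb≈±

      split : ∃[ r ] (sum f ≡ f ja + (f jb + r) × sum f′ ≡ f′ ja + (f′ jb + r))
      split = sum-agreeing-off₂ ja≢jb agree-off

  id-signedPerm : SignedPerm id
  id-signedPerm = record { w⁻¹ = id ; inverseʳ = λ _ → refl ; injective = id ; odd = λ _ → refl }

  fixes-positive⇒≗id : ∀ {w} → SignedPerm w → (∀ j → w (pos j) ≡ pos j) → w ≗ id
  fixes-positive⇒≗id {w} σ w-pos x with absolute x
  ... | j , inj₁ j≡x  = trans (cong w (sym j≡x)) (trans (w-pos j) j≡x)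
  ... | j , inj₂ j≡-x = begin
    w x                       ≡⟨ cong w (sym (trans (cong opposite j≡-x) (Fₚ.opposite-involutive x))) ⟩
    w (opposite (pos j))      ≡⟨ SignedPerm.odd σ (pos j) ⟩
    opposite (w (pos j))      ≡⟨ cong opposite (trans (w-pos j) j≡-x) ⟩
    opposite (opposite x)     ≡⟨ Fₚ.opposite-involutive x ⟩
    x                         ∎
    where open ≡-Reasoning

  opposite-pos-opposite : (i : Fin n) → opposite (pos (opposite i)) ≡ n ↑ʳ i
  opposite-pos-opposite i = Fₚ.toℕ-injective (begin
    toℕ (opposite (pos (opposite i)))  ≡⟨ Fₚ.opposite-prop (pos (opposite i)) ⟩
    n + n ∸ suc (toℕ (pos (opposite i))) ≡⟨ cong (λ m → n + n ∸ suc m) (trans (toℕ-pos _) (Fₚ.opposite-prop i)) ⟩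
    n + n ∸ suc (n ∸ suc (toℕ i))      ≡⟨ cong (n + n ∸_) (ℕₚ.+-∸-assoc 1 (Fₚ.toℕ<n i)) ⟨
    n + n ∸ (n ∸ toℕ i)                ≡⟨ ℕₚ.+-∸-assoc n (ℕₚ.m∸n≤m n (toℕ i)) ⟩
    n + (n ∸ (n ∸ toℕ i))              ≡⟨ cong (n +_) (ℕₚ.m∸[m∸n]≡n (ℕₚ.<⇒≤ (Fₚ.toℕ<n i))) ⟩
    n + toℕ i                          ≡⟨ Fₚ.toℕ-↑ʳ n i ⟨
    toℕ (n ↑ʳ i)                       ∎)
    where open ≡-Reasoning

  unfold-odd : ∀ {u} → (∀ x → u (opposite x) ≡ opposite (u x)) → unfold n u ≗ u
  unfold-odd {u} u-odd p with F.splitAt n p in split≡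
  ... | inj₁ i = cong u (Fₚ.splitAt⁻¹-↑ˡ split≡)
  ... | inj₂ i = begin
    opposite (u (pos (opposite i)))  ≡⟨ u-odd (pos (opposite i)) ⟨
    u (opposite (pos (opposite i)))  ≡⟨ cong u (trans (opposite-pos-opposite i) (Fₚ.splitAt⁻¹-↑ʳ split≡)) ⟩
    u p                              ∎
    where open ≡-Reasoning

  hChoice-stop : ∀ {t q u} → ¬ (posIn n u t ℕ.< posIn n u q) → hChoice n t (q ∷ []) u ≡ nothing
  hChoice-stop {t} {q} {u} t-not-before-q =
    cong last (filter-reject (λ q → (t Fₚ.<? q) ×-dec (posIn n u t ℕ.<? posIn n u q)) (t-not-before-q ∘ proj₂))

  hChoice-step : ∀ {t q u} → t < q → posIn n u t ℕ.< posIn n u q → hChoice n t (q ∷ []) u ≡ just q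
  hChoice-step {t} {q} {u} t<q t-before-q =
    cong last (filter-accept (λ q → (t Fₚ.<? q) ×-dec (posIn n u t ℕ.<? posIn n u q)) (t<q , t-before-q))

  hIter-stop : ∀ {fuel t L u} → hChoice n t L u ≡ nothing → hIter n (suc fuel) t L u ≡ u
  hIter-stop stop rewrite stop = refl

  hIter-step : ∀ {fuel t L u q} → hChoice n t L u ≡ just q →
               hIter n (suc fuel) t L u ≡ hIter n fuel t L (sswap n t q ∘ u)
  hIter-step step rewrite step = refl

  module _ {u} (σ : SignedPerm u) where
    open SignedPerm σ

    -- posIn scans allFin with a local function; abstracting allFin lets Agda infer that function.
    posIn-w⁻¹ : ∀ x → posIn n u x ≡ toℕ (w⁻¹ x)
    posIn-w⁻¹ x
      with first-match (λ p → unfold n u p F.≟ x) toℕ _ (λ _ _ → refl) id (w⁻¹ x)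
             (trans (unfold-odd odd (w⁻¹ x)) (inverseʳ x))
             (λ p unfold≡x → w≡⇒≡w⁻¹ (trans (sym (unfold-odd odd p)) unfold≡x))
         | allFin (n + n) in allFin≡
    ... | match | _ = match allFin≡

    hIter-stops : ∀ {fuel t q} → ¬ (w⁻¹ t < w⁻¹ q) → hIter n (suc fuel) t (q ∷ []) u ≡ u
    hIter-stops {fuel} {t} {q} t≮q =
      hIter-stop {fuel} {t} {q ∷ []} (hChoice-stop {t} {q} λ t-before-q →
        t≮q (subst₂ ℕ._<_ (posIn-w⁻¹ t) (posIn-w⁻¹ q) t-before-q))

    hIter-swaps : ∀ {fuel t q} → t < q → w⁻¹ t < w⁻¹ q →
                  hIter n (suc fuel) t (q ∷ []) u ≡ hIter n fuel t (q ∷ []) (sswap n t q ∘ u)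
    hIter-swaps {fuel} {t} {q} t<q t<q-in-u =
      hIter-step {fuel} {t} {q ∷ []}
        (hChoice-step {t} {q} t<q (subst₂ ℕ._<_ (sym (posIn-w⁻¹ t)) (sym (posIn-w⁻¹ q)) t<q-in-u))

  module _ {a b w} (ρ : IsReflection (sswap n a b) a b) (σ : SignedPerm w) where
    open IsReflection ρ
    open SignedPerm σ using (w⁻¹)

    private
      σ′ = reflection∘signedPerm ρ σ

    hIter-ascent : w⁻¹ a < w⁻¹ b → ∀ fuel → hIter n (suc fuel) a (b ∷ []) (sswap n a b ∘ w) ≡ sswap n a b ∘ w
    hIter-ascent α<β fuel =
      hIter-stops σ′ (subst₂ (λ x y → ¬ (w⁻¹ x < w⁻¹ y)) (sym a↦b) (sym b↦a) (Fₚ.<-asym α<β))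

    hIter-descent : w⁻¹ b < w⁻¹ a → ∀ fuel →
                    hIter n (suc (suc fuel)) a (b ∷ []) (sswap n a b ∘ w) ≡ sswap n a b ∘ sswap n a b ∘ w
    hIter-descent β<α fuel = trans
      (hIter-swaps σ′ a<b (subst₂ (λ x y → w⁻¹ x < w⁻¹ y) (sym a↦b) (sym b↦a) β<α))
      (hIter-stops (reflection∘signedPerm ρ σ′)
        (subst₂ (λ x y → ¬ (w⁻¹ x < w⁻¹ y)) (sym (involutive a)) (sym (involutive b)) (Fₚ.<-asym β<α)))

-- The group D_n, n = k + 2

module TypeD (k : ℕ) where

  n : ℕ
  n = suc (suc k)

  open Signed n

  rootˡ rootʳ : Gen k → PM n
  rootˡ (typeA j) = pos (inject₁ j)
  rootˡ spin      = pos (inject₁ (fromℕ k))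
  rootʳ (typeA j) = pos (F.suc j)
  rootʳ spin      = opposite (pos (fromℕ (suc k)))

  toℕ-pos-inject₁ : (j : Fin (suc k)) → toℕ (pos {n} (inject₁ j)) ≡ toℕ j
  toℕ-pos-inject₁ j = trans (toℕ-pos (inject₁ j)) (Fₚ.toℕ-inject₁ j)

  toℕ-pos-last : toℕ (pos {n} (fromℕ (suc k))) ≡ suc k
  toℕ-pos-last = trans (toℕ-pos (fromℕ (suc k))) (Fₚ.toℕ-fromℕ (suc k))

  toℕ-rootˡ-spin : toℕ (rootˡ spin) ≡ k
  toℕ-rootˡ-spin = trans (toℕ-pos-inject₁ (fromℕ k)) (Fₚ.toℕ-fromℕ k)

  toℕ-rootʳ-spin : toℕ (rootʳ spin) ≡ n
  toℕ-rootʳ-spin = trans (Fₚ.opposite-prop (pos (fromℕ (suc k))))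
                         (trans (cong (λ m → n + n ∸ suc m) toℕ-pos-last) (ℕₚ.m+n∸n≡m n n))

  root-< : ∀ g → rootˡ g < rootʳ g
  root-< (typeA j) = subst₂ ℕ._<_ (sym (toℕ-pos-inject₁ j)) (sym (toℕ-pos (F.suc j))) (ℕₚ.n<1+n (toℕ j))
  root-< spin      = subst₂ ℕ._<_ (sym toℕ-rootˡ-spin) (sym toℕ-rootʳ-spin)
                       (ℕₚ.m<n⇒m<1+n (ℕₚ.n<1+n k))

  root-<- : ∀ g → rootʳ g < opposite (rootˡ g)
  root-<- (typeA j) = ℕₚ.<-≤-trans (pos-positive (F.suc j)) (opposite-positive (pos-positive (inject₁ j)))
  root-<- spin      = <-opposite (subst (rootˡ spin <_) (sym (Fₚ.opposite-involutive _))
                        (subst₂ ℕ._<_ (sym toℕ-rootˡ-spin) (sym toℕ-pos-last)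
                          (ℕₚ.n<1+n k)))

  root-between : ∀ g {z} → rootˡ g < z → z < rootʳ g → z ≡ opposite (rootʳ g)
  root-between (typeA j) {z} a<z z<b = contradiction
    (ℕₚ.≤-pred (subst (toℕ z ℕ.<_) (toℕ-pos (F.suc j)) z<b))
    (ℕₚ.<⇒≱ (subst (ℕ._< toℕ z) (toℕ-pos-inject₁ j) a<z))
  root-between spin {z} a<z z<b = Fₚ.toℕ-injective (begin
    toℕ z                                  ≡⟨ ℕₚ.≤-antisym (ℕₚ.≤-pred z<n) k<z ⟩
    suc k                                  ≡⟨ toℕ-pos-last ⟨
    toℕ (pos (fromℕ (suc k)))              ≡⟨ cong toℕ (Fₚ.opposite-involutive _) ⟨
    toℕ (opposite (rootʳ spin))            ∎)
    where
    open ≡-Reasoning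
    k<z : k ℕ.< toℕ z
    k<z = subst (ℕ._< toℕ z) toℕ-rootˡ-spin a<z
    z<n : toℕ z ℕ.< n
    z<n = subst (toℕ z ℕ.<_) toℕ-rootʳ-spin z<b

  gen-signedTransposition : ∀ g → IsSignedTransposition (gen k g) (rootˡ g) (rootʳ g)
  gen-signedTransposition g@(typeA _) = sswap-isSignedTransposition (root-< g) (root-<- g)
  gen-signedTransposition spin        = sswap-isSignedTransposition (root-< spin) (root-<- spin)

  gen-reflection : ∀ g → IsReflection (gen k g) (rootˡ g) (rootʳ g)
  gen-reflection g =
    signedTransposition⇒reflection (gen-signedTransposition g) (root-< g) (root-<- g) (root-between g)

  signedPerm : ∀ {w} → InD n w → SignedPerm w
  signedPerm = isSignedPerm⇒SignedPerm ∘ proj₁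

  negCount-parity-gen : ∀ g {w} → SignedPerm w → 2 ∣ negCount n w → 2 ∣ negCount n (gen k g ∘ w)
  negCount-parity-gen g@(typeA j) {w} _ =
    subst (2 ∣_) (sym (negCount-preserved (gen-signedTransposition g)
                         (pos-positive (inject₁ j)) (pos-positive (F.suc j)) w))
  negCount-parity-gen spin =
    negCount-parity-preserved (gen-signedTransposition spin) (pos-positive (inject₁ (fromℕ k)))
      (opposite-positive (pos-positive (fromℕ (suc k)))) (root-< spin) (root-<- spin)

  InD-gen : ∀ g {w} → InD n w → InD n (gen k g ∘ w)
  InD-gen g D = signedPerm⇒IsSignedPerm (reflection∘signedPerm (gen-reflection g) (signedPerm D)) ,
                negCount-parity-gen g (signedPerm D) (proj₂ D)

  -- The positions w⁻¹ 1 < … < w⁻¹ n of 1, …, n in w increase; the spin ascent forces the first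
  -- n - 1 of them to be positive, and if the last one were negative, -n would be the only
  -- negative entry of w.
  module _ {w} (σ : SignedPerm w) (2∣negCount : 2 ∣ negCount n w)
           (ascent : ∀ g → SignedPerm.w⁻¹ σ (rootˡ g) < SignedPerm.w⁻¹ σ (rootʳ g)) where
    open SignedPerm σ

    private
      position : Fin n → ℕ
      position i = toℕ (w⁻¹ (pos i))

      position-increasing : Increasing position
      position-increasing j = ascent (typeA j)

      X : PM n
      X = w⁻¹ (pos (fromℕ (suc k)))

      penultimate-positive : position (inject₁ (fromℕ k)) ℕ.< n
      penultimate-positive with toℕ X ℕ.<? n
      ... | yes X<n = ℕₚ.<-trans (ascent (typeA (fromℕ k))) X<n
      ... | no  X≮n = ℕₚ.<-trans (subst (w⁻¹ (rootˡ spin) <_) (w⁻¹-odd _) (ascent spin))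
                                 (opposite-negative (ℕₚ.≮⇒≥ X≮n))

      non-last-positive : ∀ c → toℕ c ≢ suc k → position c ℕ.< n
      non-last-positive c c≢last = ℕₚ.≤-<-trans
        (subst (λ c → position c ℕ.≤ position (inject₁ (fromℕ k))) (Fₚ.inject₁-lower₁ c (c≢last ∘ sym))
          (ℕₚ.≤-trans (ℕₚ.m≤m+n _ _) (increasing-≤ {f = position ∘ inject₁} (position-increasing ∘ inject₁) _)))
        penultimate-positive

      negative-X⇒negCount≡1 : Negative X → negCount n w ≡ 1
      negative-X⇒negCount≡1 X-negative = trans (negCount-sum w) (sum-single j₀ f-j₀ f-others)
        where
        j₀ = proj₁ (absolute X)
        j₀≡-X : pos j₀ ≡ opposite X
        j₀≡-X with proj₂ (absolute X)
        ... | inj₁ j₀≡X  = contradiction (subst Negative (sym j₀≡X) X-negative) (ℕₚ.<⇒≱ (pos-positive j₀))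
        ... | inj₂ j₀≡-X = j₀≡-X
        f-j₀ : 𝟙-negative (w (pos j₀)) ≡ 1
        f-j₀ = indicator-yes (subst Negative (sym w-j₀) (opposite-positive (pos-positive (fromℕ (suc k))))) _
          where
          w-j₀ : w (pos j₀) ≡ opposite (pos (fromℕ (suc k)))
          w-j₀ = trans (cong w j₀≡-X) (trans (odd X) (cong opposite (inverseʳ _)))
        f-others : ∀ j → j ≢ j₀ → 𝟙-negative (w (pos j)) ≡ 0
        f-others j j≢j₀ = indicator-no w-j-positive _
          where
          w-j-positive : ¬ Negative (w (pos j))
          w-j-positive w-j-negative = j≢j₀ (absolute-unique (inj₂ j≡-X) (proj₂ (absolute X)))
            where
            c = proj₁ (absolute (w (pos j)))
            c≡-wj : pos c ≡ opposite (w (pos j))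
            c≡-wj with proj₂ (absolute (w (pos j)))
            ... | inj₁ c≡wj  = contradiction (subst Negative (sym c≡wj) w-j-negative) (ℕₚ.<⇒≱ (pos-positive c))
            ... | inj₂ c≡-wj = c≡-wj
            w⁻¹c≡-j : w⁻¹ (pos c) ≡ opposite (pos j)
            w⁻¹c≡-j = trans (cong w⁻¹ c≡-wj) (trans (w⁻¹-odd _) (cong opposite (inverseˡ (pos j))))
            c-last : c ≡ fromℕ (suc k)
            c-last with toℕ c ℕ.≟ suc k
            ... | yes c≡last = Fₚ.toℕ-injective (trans c≡last (sym (Fₚ.toℕ-fromℕ (suc k))))
            ... | no  c≢last = contradiction (subst Negative (sym w⁻¹c≡-j) (opposite-positive (pos-positive j)))
                                             (ℕₚ.<⇒≱ (non-last-positive c c≢last))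
            j≡-X : pos j ≡ opposite X
            j≡-X = trans (sym (Fₚ.opposite-involutive (pos j)))
                         (cong opposite (trans (sym w⁻¹c≡-j) (cong (w⁻¹ ∘ pos) c-last)))

    ascent-free⇒≗id : w ≗ id
    ascent-free⇒≗id with toℕ X ℕ.<? n
    ... | yes X<n = fixes-positive⇒≗id σ λ j →
      trans (cong w (sym (w⁻¹-fixes j))) (inverseʳ (pos j))
      where
      w⁻¹-fixes : ∀ j → w⁻¹ (pos j) ≡ pos j
      w⁻¹-fixes j = Fₚ.toℕ-injective
        (trans (increasing-≡toℕ position-increasing (ℕₚ.≤-pred X<n) j) (sym (toℕ-pos j)))
    ... | no  X≮n = contradiction (subst (2 ∣_) (negative-X⇒negCount≡1 (ℕₚ.≮⇒≥ X≮n)) 2∣negCount) λ 2∣1 →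
      contradiction (∣1⇒≡1 2∣1) λ ()

  module _ {w} (D : InD n w) where
    open SignedPerm (signedPerm D)

    descent-or-≗id : (∃[ g ] w⁻¹ (rootʳ g) < w⁻¹ (rootˡ g)) ⊎ w ≗ id
    descent-or-≗id with Fₚ.any? (λ j → w⁻¹ (rootʳ (typeA j)) Fₚ.<? w⁻¹ (rootˡ (typeA j)))
                      | w⁻¹ (rootʳ spin) Fₚ.<? w⁻¹ (rootˡ spin)
    ... | yes (j , descent) | _            = inj₁ (typeA j , descent)
    ... | no _              | yes descent  = inj₁ (spin , descent)
    ... | no ¬descent-A     | no ¬descent-N = inj₂ (ascent-free⇒≗id (signedPerm D) (proj₂ D) ascent)
      where
      w⁻¹-roots-distinct : ∀ g → w⁻¹ (rootˡ g) ≢ w⁻¹ (rootʳ g)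
      w⁻¹-roots-distinct g = Fₚ.<⇒≢ (root-< g) ∘ w⁻¹-injective
      ascent : ∀ g → w⁻¹ (rootˡ g) < w⁻¹ (rootʳ g)
      ascent g@(typeA j) = ≢∧≯⇒< (w⁻¹-roots-distinct g) (λ descent → ¬descent-A (j , descent))
      ascent spin        = ≢∧≯⇒< (w⁻¹-roots-distinct spin) ¬descent-N

  prod-signedPerm : ∀ ws → SignedPerm (prod k ws)
  prod-signedPerm []       = id-signedPerm
  prod-signedPerm (g ∷ ws) = reflection∘signedPerm (gen-reflection g) (prod-signedPerm ws)

  inversions-prod-≤ : ∀ ws → inversions (prod k ws) ℕ.≤ length ws
  inversions-prod-≤ []       = ℕₚ.≤-reflexive inversions-id
  inversions-prod-≤ (g ∷ ws) =
    ℕₚ.≤-trans (inversions-step-≤ (gen-reflection g) (prod-signedPerm ws)) (s≤s (inversions-prod-≤ ws))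

  reduced-word : ∀ m {w} → InD n w → inversions w ≡ m → ∃[ ws ] (length ws ≡ m × prod k ws ≗ w)
  reduced-word m {w} D inv≡m with descent-or-≗id D
  reduced-word m D inv≡m | inj₂ w≗id =
    [] , trans (sym (trans (inversions-cong w≗id) inversions-id)) inv≡m , sym ∘ w≗id
  reduced-word zero D inv≡0 | inj₁ (g , descent) =
    contradiction (trans (sym inv≡0) (inversions-descent (gen-reflection g) (signedPerm D) descent)) λ ()
  reduced-word (suc m) {w} D inv≡1+m | inj₁ (g , descent)
    with reduced-word m (InD-gen g D)
           (ℕₚ.suc-injective
             (trans (sym (inversions-descent (gen-reflection g) (signedPerm D) descent)) inv≡1+m))
  ... | ws , length≡m , prod≗gw =
    g ∷ ws , cong suc length≡m ,
    λ x → trans (cong (gen k g) (prod≗gw x)) (IsReflection.involutive (gen-reflection g) (w x))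

  inversions-isLength : ∀ {w} → InD n w → IsLength k w (inversions w)
  inversions-isLength D =
    reduced-word _ D refl ,
    λ ws prod≗w → ℕₚ.≤-trans (ℕₚ.≤-reflexive (sym (inversions-cong prod≗w))) (inversions-prod-≤ ws)

  demazure : ∀ {a b w} → IsReflection (sswap n a b) a b → InD n w → InD n (sswap n a b ∘ w) →
             DemazureIs k (sswap n a b) w (h n a (b ∷ []) (sswap n a b ∘ w))
  demazure {a} {b} {w} ρ D D′ =
    inversions w , inversions (s ∘ w) , inversions-isLength D , inversions-isLength D′ , compare
    where
    s = sswap n a b
    σ = signedPerm D
    open SignedPerm σ using (w⁻¹; w⁻¹-injective)
    open IsReflection ρ using (a<b; involutive)
    compare : (inversions w ℕ.< inversions (s ∘ w) × h n a (b ∷ []) (s ∘ w) ≗ s ∘ w)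
            ⊎ (inversions (s ∘ w) ℕ.≤ inversions w × h n a (b ∷ []) (s ∘ w) ≗ w)
    compare with Fₚ.<-cmp (w⁻¹ a) (w⁻¹ b)
    ... | tri< α<β _ _ = inj₁ (ℕₚ.≤-reflexive (sym (inversions-ascent ρ σ α<β)) ,
                               cong-app (hIter-ascent ρ σ α<β _))
    ... | tri≈ _ α≡β _ = contradiction (w⁻¹-injective α≡β) (Fₚ.<⇒≢ a<b)
    ... | tri> _ _ β<α = inj₂ (ℕₚ.≤-trans (ℕₚ.n≤1+n _) (ℕₚ.≤-reflexive (sym (inversions-descent ρ σ β<α))) ,
                               λ x → trans (cong-app (hIter-descent ρ σ β<α _) x) (involutive (w x)))

  demazure-gen : ∀ g {w} → InD n w → DemazureIs k (gen k g) w (h n (rootˡ g) (rootʳ g ∷ []) (gen k g ∘ w))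
  demazure-gen g@(typeA _) D = demazure (gen-reflection g) D (InD-gen g D)
  demazure-gen spin        D = demazure (gen-reflection spin) D (InD-gen spin D)

mainTheorem4 : (k : ℕ) (w : PM (suc (suc k)) → PM (suc (suc k)))
    → InD (suc (suc k)) w
    → ((j : Fin (suc k))
        → DemazureIs k (sA k j) w
            (h (suc (suc k)) (pos (inject₁ j)) (pos (F.suc j) ∷ []) (sA k j ∘ w)))
      × DemazureIs k (sN k) w
          (h (suc (suc k)) (pos (inject₁ (fromℕ k))) (neg (suc (suc k)) (pos (fromℕ (suc k))) ∷ []) (sN k ∘ w))
mainTheorem4 k w D = (λ j → demazure-gen (typeA j) D) , demazure-gen spin D
  where open TypeD k
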